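{- Let $S$ be a set of $m\ge2$ finite strings, no one a substring of another, let $S'$ be obtained from $S$ by the small-cycle modification, and let $\mathcal{C}=\mathcal{C}(S')$. Let $u,v,u',v'\in S'$ (not necessarily distinct) and consider the edges $e=(u,v)$, $f=(v',v)$, $f'=(u,u')$, $e'=(v',u')$ of the overlap graph of $S'$, and suppose $e$ is an edge of a small cycle $c$ of $\mathcal{C}$. Then $$|\mathrm{ov}(e)|+|\mathrm{ov}(e')|-|\mathrm{ov}(f)|-|\mathrm{ov}(f')|\ >\ |\mathrm{ov}(e)|-\max\{|\mathrm{ov}(f)|,|\mathrm{ov}(f')|\}-w(c).$$
   Context: For strings $s\neq t$, $\mathrm{ov}(s,t)$ is the longest suffix of $s$ that is a prefix of $t$; $\mathrm{ov}(s,s)$ is the longest suffix of $s$ of length less than $|s|$ that is also a prefix of $s$; $s=\mathrm{pref}(s,t)\mathrm{ov}(s,t)$, $\mathrm{dist}(s,t)=|\mathrm{pref}(s,t)|$; for an edge $g=(s,t)$, $\mathrm{ov}(g)=\mathrm{ov}(s,t)$. The overlap graph of a set $T$ is the complete directed graph with self-loops on $T$ with edge profits $|\mathrm{ov}|$. $\mathcal{C}(T)$ is the cycle cover computed by MGREEDY (fixed tie-breaking): sort all ordered pairs $(s,t)$ of $T$ (including $s=t$) by non-increasing $|\mathrm{ov}(s,t)|$, scan and add $(s,t)$ iff no previously added edge has tail $s$ or head $t$. Write each cycle as $c=s_{c_0}\to\dots\to s_{c_{r-1}}\to s_{c_0}$ where $(s_{c_{r-1}},s_{c_0})$ is its cycle-closing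 edge (last edge of $c$ added); $w(c)$ is the sum of $\mathrm{dist}$ over its edges and $o(c)=|\mathrm{ov}(s_{c_{r-1}},s_{c_0})|$. A cycle is small if $o(c)>2w(c)$. Small-cycle modification: for each small cycle $c$ of $\mathcal{C}(S)$, remove all strings of $c$ from $S$ and add $R'_c=\mathrm{pref}(s_{c_0},s_{c_1})\cdots\mathrm{pref}(s_{c_{r-2}},s_{c_{r-1}})\mathrm{pref}(s_{c_{r-1}},s_{c_0})\,s_{c_0}$; the result is $S'$. -}

module Defs where

open import Data.Bool using (Bool; true; false; if_then_else_; _∨_)
open import Data.Nat using (ℕ; zero; suc; _+_; _*_; _∸_; _<_; _≤_)
open import Data.List using (List; []; _∷_; _++_; [_]; length; take; drop; zip; map; concat; cartesianProduct)
open import Data.Bool.ListAction using (any)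
open import Data.Nat.ListAction using (sum)
open import Data.List.Properties using (≡-dec)
open import Data.List.Membership.Propositional using (_∈_)
open import Data.List.Relation.Unary.All using (All)
open import Data.List.Relation.Unary.Unique.Propositional using (Unique)
open import Data.List.Relation.Unary.AllPairs using (AllPairs)
open import Data.List.Relation.Binary.Permutation.Propositional using (_↭_)
open import Data.Product using (_×_; _,_; proj₁; proj₂; ∃; ∃₂)
open import Data.Sum using (_⊎_)
open import Relation.Binary.PropositionalEquality using (_≡_; _≢_)
open import Relation.Binary.Definitions using (DecidableEquality)
open import Relation.Nullary using (¬_; Dec; yes; no)
open import Relation.Nullary.Decidable using (⌊_⌋)

module Strings {A : Set} (_≟A_ : DecidableEquality A) where

  Str : Set
  Str = List A

  _≟_ : DecidableEquality Str
  _≟_ = ≡-dec _≟A_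

  IsSubstring : Str → Str → Set
  IsSubstring s t = ∃₂ λ p q → t ≡ p ++ s ++ q

  -- the suffix of s of length k equals the prefix of t of length k
  -- (this forces k ≤ |s| and k ≤ |t| when k ≤ |s| is given)
  OvAt : Str → Str → ℕ → Set
  OvAt s t k = drop (length s ∸ k) s ≡ take k t

  ovAt? : (s t : Str) (k : ℕ) → Dec (OvAt s t k)
  ovAt? s t k = drop (length s ∸ k) s ≟ take k t

  bestOv : Str → Str → ℕ → ℕ
  bestOv s t zero    = zero
  bestOv s t (suc k) with ovAt? s t (suc k)
  ... | yes _ = suc k
  ... | no  _ = bestOv s t k

  -- |ov(s,t)|: longest suffix of s that is a prefix of t; if s = t the
  -- suffix must be proper (length < |s|).
  ovLen : Str → Str → ℕ
  ovLen s t with s ≟ t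
  ... | yes _ = bestOv s t (length s ∸ 1)
  ... | no  _ = bestOv s t (length s)

  ov : Str → Str → Str
  ov s t = drop (length s ∸ ovLen s t) s

  pref : Str → Str → Str
  pref s t = take (length s ∸ ovLen s t) s

  dist : Str → Str → ℕ
  dist s t = length (pref s t)

  Edge : Set
  Edge = Str × Str

  ovE : Edge → ℕ
  ovE g = ovLen (proj₁ g) (proj₂ g)

  distE : Edge → ℕ
  distE g = dist (proj₁ g) (proj₂ g)

  allPairs : List Str → List Edge
  allPairs T = cartesianProduct T T

  -- an admissible scanning order: all pairs, sorted by non-increasing
  -- overlap (ties broken arbitrarily but fixed by the order itself)
  GreedyOrder : List Str → List Edge → Set
  GreedyOrder T ord = (ord ↭ allPairs T) × AllPairs (λ g h → ovE h ≤ ovE g) ord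

  blocked : List Edge → Edge → Bool
  blocked acc g = any (λ h → ⌊ proj₁ h ≟ proj₁ g ⌋ ∨ ⌊ proj₂ h ≟ proj₂ g ⌋) acc

  scan : List Edge → List Edge → List Edge
  scan acc []      = acc
  scan acc (g ∷ gs) = if blocked acc g then scan acc gs else scan (acc ++ [ g ]) gs

  mgreedy : List Edge → List Edge
  mgreedy ord = scan [] ord

  -- Cycles of a cover, written  x₀ → x₁ → … → x_{r-1} → x₀
  -- with vertex list  x ∷ xs  (x = x₀).

  lastOr : Str → List Str → Str
  lastOr d []       = d
  lastOr d (y ∷ ys) = lastOr y ys

  cycEdges : Str → List Str → List Edge
  cycEdges x xs = zip (x ∷ xs) (xs ++ [ x ])

  closingEdge : Str → List Str → Edge
  closingEdge x xs = (lastOr x xs , x)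

  wCyc : Str → List Str → ℕ
  wCyc x xs = sum (map distE (cycEdges x xs))

  oCyc : Str → List Str → ℕ
  oCyc x xs = ovE (closingEdge x xs)

  -- x ∷ xs is a cycle of the cover C (C = list of chosen edges in the
  -- order they were added), rotated so that its cycle-closing edge
  -- (the last of its edges added) is (x_{r-1}, x₀).
  IsCycleOf : List Edge → Str → List Str → Set
  IsCycleOf C x xs =
    Unique (x ∷ xs) ×
    All (_∈ C) (cycEdges x xs) ×
    ∃₂ λ pre post → (C ≡ pre ++ closingEdge x xs ∷ post)
                    × All (_∈ pre ++ [ closingEdge x xs ]) (cycEdges x xs)

  Small : Str → List Str → Set
  Small x xs = 2 * wCyc x xs < oCyc x xs

  IsSmallCycleOf : List Edge → Str → List Str → Set
  IsSmallCycleOf C x xs = IsCycleOf C x xs × Small x xs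

  merged : Str → List Str → Str
  merged x xs = concat (map (λ g → pref (proj₁ g) (proj₂ g)) (cycEdges x xs)) ++ x

  InSmallCycle : List Edge → Str → Set
  InSmallCycle C s = ∃₂ λ x xs → IsSmallCycleOf C x xs × s ∈ x ∷ xs

  IsModification : List Edge → List Str → List Str → Set
  IsModification C S S' =
    Unique S' ×
    (∀ z → z ∈ S' → (z ∈ S × ¬ InSmallCycle C z)
                     ⊎ (∃₂ λ x xs → IsSmallCycleOf C x xs × z ≡ merged x xs)) ×
    (∀ z → z ∈ S → ¬ InSmallCycle C z → z ∈ S') ×
    (∀ x xs → IsSmallCycleOf C x xs → merged x xs ∈ S')

  SubstringFree : List Str → Set
  SubstringFree S = ∀ s t → s ∈ S → t ∈ S → s ≢ t → ¬ IsSubstring s t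

{-# OPTIONS --safe #-}
-- Let b, c, d be the overlap lengths of (v′,u′), (v′,v), (u,u′) and w the weight of the small cycle.
-- As c + d = min c d + max c d, the inequality says min c d < b + w. Going around the cycle from v back
-- to u shows that Z = pref(u,v) v is a prefix of P Z for a word P of length w, so Z has period w;
-- w ≥ 1 because the cycle is small, and u is a prefix of Z. If b + w ≤ min c d, the c-suffix of v′ (a
-- prefix of v) and the d-prefix of u′ (a suffix of u) are windows of length ≥ b + w in Z. Starting a
-- k-suffix of the first window at a position congruent mod w to the start of the second, with
-- b < k ≤ b + w, periodicity yields a suffix of v′ equal to a prefix of u′ of length k. Since S′ is
-- prefix-free, k ≤ c < |v′|, so k is an admissible overlap of (v′,u′) longer than the maximal one b.
module Submission where

open import Data.Bool using (true; false)
open import Data.Bool.Properties using (∨-conicalʳ)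
open import Data.Empty using (⊥; ⊥-elim)
open import Data.List using (List; []; _∷_; _++_; [_]; length; take; drop; zip; map; concat)
open import Data.List.Properties
  using (++-monoid; ++-assoc; length-++; length-take; length-drop; take++drop≡id; take-take; take-drop; drop-drop; drop-all; map-++)
open import Data.List.Membership.Propositional using (_∈_; _∉_)
open import Data.List.Membership.Propositional.Properties using (∈-++⁻; ∈-cartesianProductWith⁻)
open import Data.List.Relation.Binary.Permutation.Propositional.Properties using (∈-resp-↭)
open import Data.List.Relation.Binary.Pointwise using (Pointwise-≡⇒≡)
open import Data.List.Relation.Binary.Prefix.Heterogeneous using (Prefix; []; _∷_)
import Data.List.Relation.Binary.Prefix.Heterogeneous.Properties as Prefix
open import Data.List.Relation.Unary.All as All using (All; []; _∷_)
open import Data.List.Relation.Unary.All.Properties using (All¬⇒¬Any)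
open import Data.List.Relation.Unary.AllPairs using (AllPairs; []; _∷_)
import Data.List.Relation.Unary.AllPairs.Properties as AllPairs
open import Data.List.Relation.Unary.Any using (here; there)
open import Data.List.Relation.Unary.Unique.Propositional using (Unique)
open import Data.Nat using (ℕ; zero; suc; _*_; _∸_; _⊓_; _≤_; _<_; z≤n; s≤s; NonZero; >-nonZero)
open import Data.Nat.DivMod using (_%_; _/_; m≡m%n+[m/n]*n; m%n<n; m%n≤n; m%n%n≡m%n; %-distribˡ-+; [m+n]%n≡m%n)
open import Data.Nat.ListAction using (sum)
open import Data.Nat.ListAction.Properties using (sum-++)
open import Data.Nat.Properties hiding (_≟_)
open import Data.Nat.Tactic.RingSolver using (solve-∀)
open import Data.Product using (∃; ∃₂; _×_; _,_; proj₁; proj₂)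
open import Data.Sum using (_⊎_; inj₁; inj₂)
import Data.Sum as Sum
open import Defs
open import Function using (_∘_)
open import Relation.Binary.Definitions using (DecidableEquality)
open import Relation.Binary.PropositionalEquality hiding ([_])
open import Relation.Nullary using (¬_; yes; no)

-- Prefixes are left divisors in the free monoid (List A, _++_, []).
module Prefixes {A : Set} where

  open import Algebra.Properties.Monoid.Divisibility (++-monoid A) public
  open import Data.List.Relation.Binary.Prefix.Propositional.Properties {A = A}

  ∣ˡ⇒length≤ : {xs ys : List A} → xs ∣ˡ ys → length xs ≤ length ys
  ∣ˡ⇒length≤ p = Prefix.length-mono (∣ˡ-as-Prefix p)

  ∣ˡ-antisym : {xs ys : List A} → xs ∣ˡ ys → ys ∣ˡ xs → xs ≡ ys
  ∣ˡ-antisym p q = Pointwise-≡⇒≡ (Prefix.antisym (λ x≡y _ → x≡y) (∣ˡ-as-Prefix p) (∣ˡ-as-Prefix q))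

  Prefix-comparable : {xs ys zs : List A} → Prefix _≡_ xs zs → Prefix _≡_ ys zs →
                      Prefix _≡_ xs ys ⊎ Prefix _≡_ ys xs
  Prefix-comparable []         _          = inj₁ []
  Prefix-comparable (_ ∷ _)    []         = inj₂ []
  Prefix-comparable (refl ∷ p) (refl ∷ q) = Sum.map (refl ∷_) (refl ∷_) (Prefix-comparable p q)

  ∣ˡ-comparable : {xs ys zs : List A} → xs ∣ˡ zs → ys ∣ˡ zs → xs ∣ˡ ys ⊎ ys ∣ˡ xs
  ∣ˡ-comparable p q = Sum.map Prefix-as-∣ˡ Prefix-as-∣ˡ (Prefix-comparable (∣ˡ-as-Prefix p) (∣ˡ-as-Prefix q))

  length≡0⇒≡[] : {xs : List A} → length xs ≡ 0 → xs ≡ []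
  length≡0⇒≡[] {[]} _ = refl

  take∣ˡ : ∀ k (xs : List A) → take k xs ∣ˡ xs
  take∣ˡ k xs = drop k xs , take++drop≡id k xs

module Periodicity where

  open import Data.Nat using (_+_)
  open Prefixes

  residue-shift : ∀ a b n .{{_ : NonZero n}} → ∃ λ j → j < n × (a + j) % n ≡ b % n
  residue-shift a b n = j , m%n<n _ n , (begin
      (a + j) % n                      ≡⟨ %-distribˡ-+ a j n ⟩
      (a % n + j % n) % n              ≡⟨ cong₂ (λ x y → (x + y) % n) (sym (m%n%n≡m%n a n)) (m%n%n≡m%n _ n) ⟩
      (r % n + (b + (n ∸ r)) % n) % n  ≡⟨ %-distribˡ-+ r (b + (n ∸ r)) n ⟨
      (r + (b + (n ∸ r))) % n          ≡⟨ cong (_% n) r+[b+[n∸r]]≡b+n ⟩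
      (b + n) % n                      ≡⟨ [m+n]%n≡m%n b n ⟩
      b % n                            ∎)
    where
    open ≡-Reasoning
    r = a % n
    j = (b + (n ∸ r)) % n
    r+[b+[n∸r]]≡b+n : r + (b + (n ∸ r)) ≡ b + n
    r+[b+[n∸r]]≡b+n = trans (+-comm r _) (trans (+-assoc b (n ∸ r) r) (cong (b +_) (m∸n+n≡m (m%n≤n a n))))

  module _ {A : Set} where

    slice : ℕ → ℕ → List A → List A
    slice i k xs = take k (drop i xs)

    slice-++ʳ : ∀ i k (xs ys : List A) → i + k ≤ length xs → slice i k (xs ++ ys) ≡ slice i k xs
    slice-++ʳ zero    zero    xs       ys _       = refl
    slice-++ʳ zero    (suc k) (x ∷ xs) ys (s≤s h) = cong (x ∷_) (slice-++ʳ zero k xs ys h)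
    slice-++ʳ (suc i) k       (x ∷ xs) ys (s≤s h) = slice-++ʳ i k xs ys h

    slice-++ˡ : ∀ i k (xs ys : List A) → slice (length xs + i) k (xs ++ ys) ≡ slice i k ys
    slice-++ˡ i k []       ys = refl
    slice-++ˡ i k (x ∷ xs) ys = slice-++ˡ i k xs ys

    slice-∣ˡ : ∀ {xs ys : List A} i k → xs ∣ˡ ys → i + k ≤ length xs → slice i k ys ≡ slice i k xs
    slice-∣ˡ {xs} i k (r , refl) h = slice-++ʳ i k xs r h

    module _ {Z P : List A} where

      private
        n = length P

      slice-+period : Z ∣ˡ (P ++ Z) → ∀ i k → i + n + k ≤ length Z → slice (i + n) k Z ≡ slice i k Z
      slice-+period (r , eq) i k h = begin
        slice (i + n) k Z         ≡⟨ slice-++ʳ (i + n) k Z r h ⟨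
        slice (i + n) k (Z ++ r)  ≡⟨ cong (slice (i + n) k) eq ⟩
        slice (i + n) k (P ++ Z)  ≡⟨ cong (λ j → slice j k (P ++ Z)) (+-comm i n) ⟩
        slice (n + i) k (P ++ Z)  ≡⟨ slice-++ˡ i k P Z ⟩
        slice i k Z               ∎
        where open ≡-Reasoning

      slice-+*period : Z ∣ˡ (P ++ Z) → ∀ i q k → i + q * n + k ≤ length Z → slice (i + q * n) k Z ≡ slice i k Z
      slice-+*period _      i zero    k _ = cong (λ j → slice j k Z) (+-identityʳ i)
      slice-+*period period i (suc q) k h = begin
        slice (i + suc q * n) k Z  ≡⟨ cong (λ j → slice j k Z) shift ⟩
        slice (i + q * n + n) k Z  ≡⟨ slice-+period period (i + q * n) k (subst (λ j → j + k ≤ length Z) shift h) ⟩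
        slice (i + q * n) k Z      ≡⟨ slice-+*period period i q k (≤-trans (+-monoˡ-≤ k (+-monoʳ-≤ i (m≤n+m (q * n) n))) h) ⟩
        slice i k Z                ∎
        where
        open ≡-Reasoning
        shift : i + suc q * n ≡ i + q * n + n
        shift = trans (cong (i +_) (+-comm n (q * n))) (sym (+-assoc i (q * n) n))

      slice-%period : Z ∣ˡ (P ++ Z) → .{{_ : NonZero n}} → ∀ i k → i + k ≤ length Z →
                      slice i k Z ≡ slice (i % n) k Z
      slice-%period period i k h =
        trans (cong (λ j → slice j k Z) i≡) (slice-+*period period (i % n) (i / n) k (subst (λ j → j + k ≤ length Z) i≡ h))
        where
        i≡ : i ≡ i % n + (i / n) * n
        i≡ = m≡m%n+[m/n]*n i n

    -- The suffix length k is chosen in (b, b + |P|] so that the suffix starts at a position congruent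
    -- to j modulo |P|.
    periodic-overlap : ∀ {Z P : List A} → Z ∣ˡ (P ++ Z) → 0 < length P →
      ∀ {i x j y} b → i + x ≤ length Z → j + y ≤ length Z → b + length P ≤ x → b + length P ≤ y →
      ∃ λ k → b < k × k ≤ x × k ≤ y × slice (i + (x ∸ k)) k Z ≡ slice j k Z
    periodic-overlap {Z} {P} period 0<n {i} {x} {j} {y} b i+x≤ j+y≤ M≤x M≤y
      with residue-shift (i + (x ∸ (b + length P))) j (length P) {{>-nonZero 0<n}}
    ... | s , s<n , aligned = k , b<k , k≤x , k≤y , agree
      where
      n = length P
      instance
        n≢0 : NonZero n
        n≢0 = >-nonZero 0<n
      M = b + n
      k = M ∸ s
      k≤x : k ≤ x
      k≤x = ≤-trans (m∸n≤m M s) M≤x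
      k≤y : k ≤ y
      k≤y = ≤-trans (m∸n≤m M s) M≤y
      b<k : b < k
      b<k = m+n≤o⇒m≤o∸n (suc b) (+-monoʳ-< b s<n)
      x≡ : x ≡ x ∸ M + s + k
      x≡ = begin
        x                ≡⟨ m∸n+n≡m M≤x ⟨
        x ∸ M + M        ≡⟨ cong (x ∸ M +_) (m+[n∸m]≡n (≤-trans (<⇒≤ s<n) (m≤n+m n b))) ⟨
        x ∸ M + (s + k)  ≡⟨ +-assoc (x ∸ M) s k ⟨
        x ∸ M + s + k    ∎
        where open ≡-Reasoning
      x∸k : x ∸ k ≡ x ∸ M + s
      x∸k = trans (cong (_∸ k) x≡) (m+n∸n≡m (x ∸ M + s) k)
      first-fits : i + (x ∸ k) + k ≤ length Z
      first-fits = subst (_≤ length Z) (trans (cong (i +_) (sym (m∸n+n≡m k≤x))) (sym (+-assoc i (x ∸ k) k))) i+x≤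
      agree : slice (i + (x ∸ k)) k Z ≡ slice j k Z
      agree = begin
        slice (i + (x ∸ k)) k Z            ≡⟨ slice-%period period (i + (x ∸ k)) k first-fits ⟩
        slice ((i + (x ∸ k)) % n) k Z      ≡⟨ cong (λ t → slice ((i + t) % n) k Z) x∸k ⟩
        slice ((i + (x ∸ M + s)) % n) k Z  ≡⟨ cong (λ t → slice (t % n) k Z) (sym (+-assoc i (x ∸ M) s)) ⟩
        slice ((i + (x ∸ M) + s) % n) k Z  ≡⟨ cong (λ t → slice t k Z) aligned ⟩
        slice (j % n) k Z                  ≡⟨ slice-%period period j k (≤-trans (+-monoʳ-≤ j k≤y) j+y≤) ⟨
        slice j k Z                        ∎
        where open ≡-Reasoning

module OverlapGraph {A : Set} (_≟A_ : DecidableEquality A) where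

  open import Data.Nat using (_+_)
  open Strings _≟A_ public
  open Prefixes
  open Periodicity

  PrefixFree : List Str → Set
  PrefixFree T = ∀ {s t} → s ∈ T → t ∈ T → s ∣ˡ t → s ≡ t

  SubstringFree⇒PrefixFree : ∀ {S} → SubstringFree S → PrefixFree S
  SubstringFree⇒PrefixFree sf {s} {t} s∈S t∈S (q , s++q≡t) with s ≟ t
  ... | yes s≡t = s≡t
  ... | no  s≢t = ⊥-elim (sf s t s∈S t∈S s≢t ([] , q , sym s++q≡t))

  prefixes-of-common-word : ∀ {T r r′ z} → PrefixFree T → r ∈ T → r′ ∈ T → r ∣ˡ z → r′ ∣ˡ z → r ≡ r′
  prefixes-of-common-word pf r∈ r′∈ r∣z r′∣z with ∣ˡ-comparable r∣z r′∣z
  ... | inj₁ r∣r′ = pf r∈ r′∈ r∣r′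
  ... | inj₂ r′∣r = sym (pf r′∈ r∈ r′∣r)

  -- Overlap lengths

  OvAt-zero : ∀ s t → OvAt s t 0
  OvAt-zero s t = drop-all (length s) s ≤-refl

  bestOv-OvAt : ∀ s t K → OvAt s t (bestOv s t K)
  bestOv-OvAt s t zero    = OvAt-zero s t
  bestOv-OvAt s t (suc K) with ovAt? s t (suc K)
  ... | yes ov = ov
  ... | no  _  = bestOv-OvAt s t K

  bestOv≤ : ∀ s t K → bestOv s t K ≤ K
  bestOv≤ s t zero    = z≤n
  bestOv≤ s t (suc K) with ovAt? s t (suc K)
  ... | yes _ = ≤-refl
  ... | no  _ = m≤n⇒m≤1+n (bestOv≤ s t K)

  ≤-bestOv : ∀ s t {K k} → k ≤ K → OvAt s t k → k ≤ bestOv s t K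
  ≤-bestOv s t {zero}  z≤n _  = z≤n
  ≤-bestOv s t {suc K} {k} k≤K ov with ovAt? s t (suc K)
  ... | yes _   = k≤K
  ... | no  ¬ov with m≤n⇒m<n∨m≡n k≤K
  ...   | inj₁ k<K  = ≤-bestOv s t (≤-pred k<K) ov
  ...   | inj₂ refl = ⊥-elim (¬ov ov)

  ovLen-OvAt : ∀ s t → OvAt s t (ovLen s t)
  ovLen-OvAt s t with s ≟ t
  ... | yes _ = bestOv-OvAt s t (length s ∸ 1)
  ... | no  _ = bestOv-OvAt s t (length s)

  ovLen≤lengthˡ : ∀ s t → ovLen s t ≤ length s
  ovLen≤lengthˡ s t with s ≟ t
  ... | yes _ = ≤-trans (bestOv≤ s t (length s ∸ 1)) (m∸n≤m (length s) 1)
  ... | no  _ = bestOv≤ s t (length s)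

  OvAt⇒≤lengthʳ : ∀ {s t k} → k ≤ length s → OvAt s t k → k ≤ length t
  OvAt⇒≤lengthʳ {s} {t} {k} k≤ ov = begin
    k                                ≡⟨ m∸[m∸n]≡n k≤ ⟨
    length s ∸ (length s ∸ k)        ≡⟨ length-drop (length s ∸ k) s ⟨
    length (drop (length s ∸ k) s)   ≡⟨ cong length ov ⟩
    length (take k t)                ≡⟨ length-take k t ⟩
    k ⊓ length t                     ≤⟨ m⊓n≤n k (length t) ⟩
    length t                         ∎
    where open ≤-Reasoning

  ovLen≤lengthʳ : ∀ s t → ovLen s t ≤ length t
  ovLen≤lengthʳ s t = OvAt⇒≤lengthʳ (ovLen≤lengthˡ s t) (ovLen-OvAt s t)

  ≤-ovLen : ∀ {s t k} → k < length s → OvAt s t k → k ≤ ovLen s t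
  ≤-ovLen {s} {t} {k} k<∣s∣ ov with s ≟ t
  ... | yes _ = ≤-bestOv s t (subst (k ≤_) (pred[m∸n]≡m∸[1+n] (length s) 0) (<⇒≤pred k<∣s∣)) ov
  ... | no  _ = ≤-bestOv s t (<⇒≤ k<∣s∣) ov

  ovLen-self<length : ∀ {s} → 0 < length s → ovLen s s < length s
  ovLen-self<length {s} 0<∣s∣ with s ≟ s
  ... | yes _ = m≤pred[n]⇒suc[m]≤n {{>-nonZero 0<∣s∣}}
                  (subst (bestOv s s (length s ∸ 1) ≤_) (sym (pred[m∸n]≡m∸[1+n] (length s) 0)) (bestOv≤ s s (length s ∸ 1)))
  ... | no s≢s = ⊥-elim (s≢s refl)

  OvAt-length⇒∣ˡ : ∀ {s t} → OvAt s t (length s) → s ∣ˡ t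
  OvAt-length⇒∣ˡ {s} {t} ov = ∣ˡ-respˡ-≈ s≡ (take∣ˡ (length s) t)
    where
    s≡ : take (length s) t ≡ s
    s≡ = trans (sym ov) (cong (λ i → drop i s) (n∸n≡0 (length s)))

  ovLen<length : ∀ {T s t} → PrefixFree T → s ∈ T → t ∈ T → 0 < ovLen s t → ovLen s t < length s
  ovLen<length {s = s} {t} prefix-free s∈T t∈T 0<ov with m≤n⇒m<n∨m≡n (ovLen≤lengthˡ s t)
  ... | inj₁ ov<∣s∣ = ov<∣s∣
  ... | inj₂ ov≡∣s∣ with prefix-free s∈T t∈T (OvAt-length⇒∣ˡ {s} {t} (subst (OvAt s t) ov≡∣s∣ (ovLen-OvAt s t)))
  ...   | refl = ovLen-self<length {s} (<-≤-trans 0<ov (ovLen≤lengthˡ s s))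

  pref++ov : ∀ s t → s ≡ pref s t ++ take (ovLen s t) t
  pref++ov s t = trans (sym (take++drop≡id (length s ∸ ovLen s t) s)) (cong (pref s t ++_) (ovLen-OvAt s t))

  ∣ˡ-pref++ : ∀ s t → s ∣ˡ (pref s t ++ t)
  ∣ˡ-pref++ s t = ∣ˡ-respˡ-≈ (sym (pref++ov s t)) (x∣ˡy⇒zx∣ˡzy (pref s t) (take∣ˡ (ovLen s t) t))

  dist≡∸ : ∀ s t → dist s t ≡ length s ∸ ovLen s t
  dist≡∸ s t = trans (length-take (length s ∸ ovLen s t) s) (m≤n⇒m⊓n≡m (m∸n≤m (length s) (ovLen s t)))

  -- Walks and cycles

  data Walk : Str → List Edge → Str → Set where
    stay : ∀ {s} → Walk s [] s
    step : ∀ {s t r es} → Walk t es r → Walk s ((s , t) ∷ es) r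

  prefs : List Edge → Str
  prefs es = concat (map (λ g → pref (proj₁ g) (proj₂ g)) es)

  weight : List Edge → ℕ
  weight es = sum (map distE es)

  length-prefs : ∀ es → length (prefs es) ≡ weight es
  length-prefs []            = refl
  length-prefs ((s , t) ∷ es) = trans (length-++ (pref s t)) (cong (dist s t +_) (length-prefs es))

  weight-++ : ∀ es fs → weight (es ++ fs) ≡ weight es + weight fs
  weight-++ es fs = trans (cong sum (map-++ distE es fs)) (sum-++ (map distE es) (map distE fs))

  walk-++ : ∀ {s es t fs r} → Walk s es t → Walk t fs r → Walk s (es ++ fs) r
  walk-++ stay     q = q
  walk-++ (step p) q = step (walk-++ p q)

  walk-split : ∀ {s es r u v} → Walk s es r → (u , v) ∈ es →
    ∃₂ λ es₁ es₂ → es ≡ es₁ ++ (u , v) ∷ es₂ × Walk s es₁ u × Walk v es₂ r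
  walk-split (step {es = es} p) (here refl) = [] , es , refl , stay , p
  walk-split (step {s} {t} p)   (there e) with walk-split p e
  ... | es₁ , es₂ , refl , p₁ , p₂ = (s , t) ∷ es₁ , es₂ , refl , step p₁ , p₂

  zip-walk : ∀ y l x → Walk y (zip (y ∷ l) (l ++ [ x ])) x
  zip-walk y []      x = step stay
  zip-walk y (z ∷ l) x = step (zip-walk z l x)

  walk-∣ˡ : ∀ {s es r} → Walk s es r → s ∣ˡ (prefs es ++ r)
  walk-∣ˡ stay = ∣ˡ-refl
  walk-∣ˡ {r = r} (step {s} {t} {es = es} p) =
    ∣ˡ-respʳ-≈ (sym (++-assoc (pref s t) (prefs es) r)) (∣ˡ-trans (∣ˡ-pref++ s t) (x∣ˡy⇒zx∣ˡzy (pref s t) (walk-∣ˡ p)))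

  merged-∣ˡ : ∀ x xs → x ∣ˡ merged x xs
  merged-∣ˡ x xs = walk-∣ˡ (zip-walk x xs x)

  cycle-return : ∀ {x xs u v} → (u , v) ∈ cycEdges x xs →
    ∃ λ Q → v ∣ˡ (Q ++ u) × dist u v + length Q ≡ wCyc x xs
  cycle-return {x} {xs} {u} {v} uv with walk-split (zip-walk x xs x) uv
  ... | es₁ , es₂ , split , x→u , v→x = prefs (es₂ ++ es₁) , walk-∣ˡ (walk-++ v→x x→u) , (begin
    dist u v + length (prefs (es₂ ++ es₁))  ≡⟨ cong (dist u v +_) (trans (length-prefs (es₂ ++ es₁)) (weight-++ es₂ es₁)) ⟩
    dist u v + (weight es₂ + weight es₁)    ≡⟨ rotate (dist u v) (weight es₂) (weight es₁) ⟩
    weight es₁ + weight ((u , v) ∷ es₂)     ≡⟨ weight-++ es₁ ((u , v) ∷ es₂) ⟨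
    weight (es₁ ++ (u , v) ∷ es₂)           ≡⟨ cong weight split ⟨
    wCyc x xs                               ∎)
    where
    open ≡-Reasoning
    rotate : ∀ a b c → a + (b + c) ≡ c + (a + b)
    rotate = solve-∀

  cycle-period : ∀ {x xs u v} → (u , v) ∈ cycEdges x xs →
    ∃ λ P → (pref u v ++ v) ∣ˡ (P ++ (pref u v ++ v)) × length P ≡ wCyc x xs
  cycle-period {u = u} {v} uv with cycle-return uv
  ... | Q , v∣Q++u , weight≡ = pref u v ++ Q , period , trans (length-++ (pref u v)) weight≡
    where
    period : (pref u v ++ v) ∣ˡ ((pref u v ++ Q) ++ (pref u v ++ v))
    period = ∣ˡ-respʳ-≈ (sym (++-assoc (pref u v) Q _))
               (x∣ˡy⇒zx∣ˡzy (pref u v) (∣ˡ-trans v∣Q++u (x∣ˡy⇒zx∣ˡzy Q (∣ˡ-pref++ u v))))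

  self-loop⇒singleton : ∀ {x xs a} → Unique (x ∷ xs) → (a , a) ∈ cycEdges x xs → xs ≡ []
  self-loop⇒singleton {x} {xs} {a} uniq@(x∉xs ∷ _) aa = proj₁ (closing uniq x∉xs aa)
    where
    closing : ∀ {y l} → Unique (y ∷ l) → All (x ≢_) l → (a , a) ∈ zip (y ∷ l) (l ++ [ x ]) → l ≡ [] × y ≡ x
    closing {l = []}    _               _           (here refl) = refl , refl
    closing {l = _ ∷ _} ((y≢z ∷ _) ∷ _) _           (here refl) = ⊥-elim (y≢z refl)
    closing {l = _ ∷ _} (_ ∷ uniq)      (x≢z ∷ x∉l) (there aa) with closing uniq x∉l aa
    ... | refl , refl = ⊥-elim (x≢z refl)

  small-loop-weight>0 : ∀ {x} → Small x [] → 0 < wCyc x []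
  small-loop-weight>0 {x} small = subst (0 <_) (trans (sym (dist≡∸ x x)) (sym (+-identityʳ (dist x x)))) 0<∣x∣∸ov
    where
    0<ov : 0 < ovLen x x
    0<ov = ≤-<-trans z≤n small
    0<∣x∣∸ov : 0 < length x ∸ ovLen x x
    0<∣x∣∸ov = m<n⇒0<n∸m (ovLen-self<length {x} (<-≤-trans 0<ov (ovLen≤lengthˡ x x)))

  weightless-cycle⇒singleton : ∀ {x xs u v} → Unique (x ∷ xs) → (u , v) ∈ cycEdges x xs → wCyc x xs ≡ 0 → xs ≡ []
  weightless-cycle⇒singleton {x} {xs} {u} {v} uniq uv w≡0 with cycle-return uv
  ... | Q , v∣Q++u , weight≡ = self-loop⇒singleton uniq (subst (λ t → (u , t) ∈ cycEdges x xs) (sym u≡v) uv)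
    where
    d+q≡0 : dist u v + length Q ≡ 0
    d+q≡0 = trans weight≡ w≡0
    u∣v : u ∣ˡ v
    u∣v = subst (λ p → u ∣ˡ (p ++ v)) (length≡0⇒≡[] (m+n≡0⇒m≡0 (dist u v) d+q≡0)) (∣ˡ-pref++ u v)
    v∣u : v ∣ˡ u
    v∣u = subst (λ q → v ∣ˡ (q ++ u)) (length≡0⇒≡[] (m+n≡0⇒n≡0 (dist u v) d+q≡0)) v∣Q++u
    u≡v : u ≡ v
    u≡v = ∣ˡ-antisym u∣v v∣u

  small-cycle-weight>0 : ∀ {x xs u v} → Unique (x ∷ xs) → Small x xs → (u , v) ∈ cycEdges x xs → 0 < wCyc x xs
  small-cycle-weight>0 {x} uniq small uv =
    n≢0⇒n>0 λ w≡0 → <⇒≢ (loop-weight>0 (weightless-cycle⇒singleton uniq uv w≡0) small) (sym w≡0)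
    where
    loop-weight>0 : ∀ {ys} → ys ≡ [] → Small x ys → 0 < wCyc x ys
    loop-weight>0 refl = small-loop-weight>0 {x}

  -- The greedy cover and the modified set

  Functional : List Edge → Set
  Functional C = ∀ {g h} → g ∈ C → h ∈ C → proj₁ g ≡ proj₁ h → g ≡ h

  TailsDistinct : List Edge → Set
  TailsDistinct = AllPairs (λ g h → proj₁ g ≢ proj₁ h)

  TailsDistinct⇒Functional : ∀ {C} → TailsDistinct C → Functional C
  TailsDistinct⇒Functional (_   ∷ _)  (here refl) (here refl) _  = refl
  TailsDistinct⇒Functional (g≢C ∷ _)  (here refl) (there h∈C) eq = ⊥-elim (All.lookup g≢C h∈C eq)
  TailsDistinct⇒Functional (h≢C ∷ _)  (there g∈C) (here refl) eq = ⊥-elim (All.lookup h≢C g∈C (sym eq))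
  TailsDistinct⇒Functional (_   ∷ td) (there g∈C) (there h∈C) eq = TailsDistinct⇒Functional td g∈C h∈C eq

  unblocked⇒new-tail : ∀ acc g → blocked acc g ≡ false → All (λ h → proj₁ h ≢ proj₁ g) acc
  unblocked⇒new-tail []        g _ = []
  unblocked⇒new-tail (h ∷ acc) g unblocked with proj₁ h ≟ proj₁ g
  ... | no h≢g = h≢g ∷ unblocked⇒new-tail acc g (∨-conicalʳ _ _ unblocked)

  scan-TailsDistinct : ∀ acc gs → TailsDistinct acc → TailsDistinct (scan acc gs)
  scan-TailsDistinct acc []       td = td
  scan-TailsDistinct acc (g ∷ gs) td with blocked acc g in unblocked
  ... | true  = scan-TailsDistinct acc gs td
  ... | false = scan-TailsDistinct (acc ++ [ g ]) gs
                  (AllPairs.++⁺ td ([] ∷ []) (All.map (_∷ []) (unblocked⇒new-tail acc g unblocked)))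

  mgreedy-Functional : ∀ ord → Functional (mgreedy ord)
  mgreedy-Functional ord = TailsDistinct⇒Functional (scan-TailsDistinct [] ord [])

  scan-⊆ : ∀ acc gs {g} → g ∈ scan acc gs → g ∈ acc ⊎ g ∈ gs
  scan-⊆ acc []       g∈ = inj₁ g∈
  scan-⊆ acc (h ∷ gs) g∈ with blocked acc h
  ... | true  = Sum.map₂ there (scan-⊆ acc gs g∈)
  ... | false with scan-⊆ (acc ++ [ h ]) gs g∈
  ...   | inj₂ g∈gs = inj₂ (there g∈gs)
  ...   | inj₁ g∈acc++h with ∈-++⁻ acc g∈acc++h
  ...     | inj₁ g∈acc      = inj₁ g∈acc
  ...     | inj₂ (here g≡h) = inj₂ (here g≡h)

  mgreedy-edge : ∀ {S ord s t} → GreedyOrder S ord → (s , t) ∈ mgreedy ord → s ∈ S × t ∈ S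
  mgreedy-edge {S} (ord↭pairs , _) st∈ with scan-⊆ [] _ st∈
  ... | inj₂ st∈ord with ∈-cartesianProductWith⁻ _,_ S S (∈-resp-↭ ord↭pairs st∈ord)
  ...   | _ , _ , s∈S , t∈S , refl = s∈S , t∈S

  cycle-head∈ : ∀ {S ord x xs} → GreedyOrder S ord → IsCycleOf (mgreedy ord) x xs → x ∈ S
  cycle-head∈ {xs = []}    greedy (_ , e∈ ∷ _ , _) = proj₁ (mgreedy-edge greedy e∈)
  cycle-head∈ {xs = _ ∷ _} greedy (_ , e∈ ∷ _ , _) = proj₁ (mgreedy-edge greedy e∈)

  first-return-unique : ∀ {C x} → Functional C → ∀ a l₁ l₂ →
    All (_∈ C) (zip (a ∷ l₁) (l₁ ++ [ x ])) → All (_∈ C) (zip (a ∷ l₂) (l₂ ++ [ x ])) →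
    x ∉ l₁ → x ∉ l₂ → l₁ ≡ l₂
  first-return-unique fun a []       []       _          _          _    _    = refl
  first-return-unique fun a []       (b ∷ l₂) (e₁ ∷ _)   (e₂ ∷ _)   _    x∉l₂ with fun e₁ e₂ refl
  ... | refl = ⊥-elim (x∉l₂ (here refl))
  first-return-unique fun a (b ∷ l₁) []       (e₁ ∷ _)   (e₂ ∷ _)   x∉l₁ _    with fun e₁ e₂ refl
  ... | refl = ⊥-elim (x∉l₁ (here refl))
  first-return-unique fun a (b ∷ l₁) (c ∷ l₂) (e₁ ∷ es₁) (e₂ ∷ es₂) x∉l₁ x∉l₂ with fun e₁ e₂ refl
  ... | refl = cong (b ∷_) (first-return-unique fun b l₁ l₂ es₁ es₂ (x∉l₁ ∘ there) (x∉l₂ ∘ there))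

  cycle-unique : ∀ {ord x xs ys} → IsCycleOf (mgreedy ord) x xs → IsCycleOf (mgreedy ord) x ys → xs ≡ ys
  cycle-unique {ord} {x} {xs} {ys} (x∉xs ∷ _ , xs∈ , _) (x∉ys ∷ _ , ys∈ , _) =
    first-return-unique (mgreedy-Functional ord) x xs ys xs∈ ys∈ (All¬⇒¬Any x∉xs) (All¬⇒¬Any x∉ys)

  -- Every string of S′ begins with a string of S that determines it: itself, or the head x of the
  -- small cycle it was merged from. Two comparable strings of S′ therefore share that string.
  modification-PrefixFree : ∀ {S ord S'} → PrefixFree S → GreedyOrder S ord →
    IsModification (mgreedy ord) S S' → PrefixFree S'
  modification-PrefixFree {ord = ord} pf greedy (_ , classify , _) {a} {b} a∈ b∈ a∣b
    with classify a a∈ | classify b b∈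
  ... | inj₁ (a∈S , _) | inj₁ (b∈S , _) = pf a∈S b∈S a∣b
  ... | inj₂ (x , xs , c , refl) | inj₁ (b∈S , b∉cycles) =
    ⊥-elim (b∉cycles (x , xs , c , here (prefixes-of-common-word pf
      b∈S (cycle-head∈ greedy (proj₁ c)) ∣ˡ-refl (∣ˡ-trans (merged-∣ˡ x xs) a∣b))))
  ... | inj₁ (a∈S , a∉cycles) | inj₂ (y , ys , d , refl) =
    ⊥-elim (a∉cycles (y , ys , d , here (prefixes-of-common-word pf
      a∈S (cycle-head∈ greedy (proj₁ d)) a∣b (merged-∣ˡ y ys))))
  ... | inj₂ (x , xs , c , refl) | inj₂ (y , ys , d , refl)
    with prefixes-of-common-word pf (cycle-head∈ greedy (proj₁ c)) (cycle-head∈ greedy (proj₁ d))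
           (∣ˡ-trans (merged-∣ˡ x xs) a∣b) (merged-∣ˡ y ys)
  ...   | refl = cong (merged x) (cycle-unique {ord} (proj₁ c) (proj₁ d))

  -- Long overlaps through a period

  OvAt⇒suffix-slice : ∀ {s t c k} → k ≤ c → c ≤ length s → OvAt s t c → drop (length s ∸ k) s ≡ slice (c ∸ k) k t
  OvAt⇒suffix-slice {s} {t} {c} {k} k≤c c≤∣s∣ ov = begin
    drop (length s ∸ k) s                  ≡⟨ cong (λ i → drop i s) ∣s∣∸k ⟩
    drop (length s ∸ c + (c ∸ k)) s        ≡⟨ drop-drop (length s ∸ c) (c ∸ k) s ⟨
    drop (c ∸ k) (drop (length s ∸ c) s)   ≡⟨ cong (drop (c ∸ k)) ov ⟩
    drop (c ∸ k) (take c t)                ≡⟨ cong (λ i → drop (c ∸ k) (take i t)) (m∸n+n≡m k≤c) ⟨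
    drop (c ∸ k) (take (c ∸ k + k) t)      ≡⟨ take-drop k (c ∸ k) t ⟨
    slice (c ∸ k) k t                      ∎
    where
    open ≡-Reasoning
    ∣s∣∸k : length s ∸ k ≡ length s ∸ c + (c ∸ k)
    ∣s∣∸k = trans (cong (_∸ k) (sym (m∸n+n≡m c≤∣s∣))) (+-∸-assoc (length s ∸ c) k≤c)

  OvAt⇒prefix-slice : ∀ {s t d k} → k ≤ d → OvAt s t d → take k t ≡ slice (length s ∸ d) k s
  OvAt⇒prefix-slice {s} {t} {d} {k} k≤d ov = begin
    take k t                      ≡⟨ cong (λ i → take i t) (m≤n⇒m⊓n≡m k≤d) ⟨
    take (k ⊓ d) t                ≡⟨ take-take k d t ⟨
    take k (take d t)             ≡⟨ cong (take k) ov ⟨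
    slice (length s ∸ d) k s      ∎
    where open ≡-Reasoning

  OvAt-from-slices : ∀ {p v u v′ u′ k} → u ∣ˡ (p ++ v) → k ≤ ovLen v′ v → k ≤ ovLen u u′ →
    slice (length p + (ovLen v′ v ∸ k)) k (p ++ v) ≡ slice (length u ∸ ovLen u u′) k (p ++ v) →
    OvAt v′ u′ k
  OvAt-from-slices {p} {v} {u} {v′} {u′} {k} u∣Z k≤c k≤d agree = begin
    drop (length v′ ∸ k) v′                 ≡⟨ OvAt⇒suffix-slice k≤c (ovLen≤lengthˡ v′ v) (ovLen-OvAt v′ v) ⟩
    slice (c ∸ k) k v                       ≡⟨ slice-++ˡ (c ∸ k) k p v ⟨
    slice (length p + (c ∸ k)) k (p ++ v)   ≡⟨ agree ⟩
    slice (length u ∸ d) k (p ++ v)         ≡⟨ slice-∣ˡ (length u ∸ d) k u∣Z fits ⟩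
    slice (length u ∸ d) k u                ≡⟨ OvAt⇒prefix-slice k≤d (ovLen-OvAt u u′) ⟨
    take k u′                               ∎
    where
    open ≡-Reasoning
    c = ovLen v′ v
    d = ovLen u u′
    fits : length u ∸ d + k ≤ length u
    fits = ≤-trans (+-monoʳ-≤ (length u ∸ d) k≤d) (≤-reflexive (m∸n+n≡m (ovLen≤lengthˡ u u′)))

  overlap-through-period : ∀ {p v u P v′ u′} b →
    (p ++ v) ∣ˡ (P ++ (p ++ v)) → 0 < length P → u ∣ˡ (p ++ v) →
    b + length P ≤ ovLen v′ v → b + length P ≤ ovLen u u′ →
    ∃ λ k → b < k × k ≤ ovLen v′ v × OvAt v′ u′ k
  overlap-through-period {p} {v} {u} {P} {v′} {u′} b period 0<∣P∣ u∣Z M≤c M≤d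
    with periodic-overlap {P = P} period 0<∣P∣ {i = length p} {j = length u ∸ ovLen u u′} b fits₁ fits₂ M≤c M≤d
    where
    fits₁ : length p + ovLen v′ v ≤ length (p ++ v)
    fits₁ = subst (length p + ovLen v′ v ≤_) (sym (length-++ p)) (+-monoʳ-≤ (length p) (ovLen≤lengthʳ v′ v))
    fits₂ : length u ∸ ovLen u u′ + ovLen u u′ ≤ length (p ++ v)
    fits₂ = subst (_≤ length (p ++ v)) (sym (m∸n+n≡m (ovLen≤lengthˡ u u′))) (∣ˡ⇒length≤ u∣Z)
  ... | k , b<k , k≤c , k≤d , agree = k , b<k , k≤c , OvAt-from-slices u∣Z k≤c k≤d agree

  period-overlap-bound : ∀ {T u v u′ v′ P} → PrefixFree T → v ∈ T → v′ ∈ T →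
    (pref u v ++ v) ∣ˡ (P ++ (pref u v ++ v)) → 0 < length P →
    ovLen v′ u′ + length P ≤ ovLen v′ v → ovLen v′ u′ + length P ≤ ovLen u u′ → ⊥
  period-overlap-bound {u = u} {v} {u′} {v′} {P} prefix-free v∈T v′∈T period 0<∣P∣ M≤c M≤d =
    let k , b<k , k≤c , ov = overlap-through-period {p = pref u v} {P = P} {v′} {u′} (ovLen v′ u′) period 0<∣P∣ (∣ˡ-pref++ u v) M≤c M≤d
        c<∣v′∣ = ovLen<length prefix-free v′∈T v∈T (<-≤-trans (≤-<-trans z≤n b<k) k≤c)
    in <⇒≱ b<k (≤-ovLen (≤-<-trans k≤c c<∣v′∣) ov)

  overlap-bound : ∀ {T x xs u v u′ v′} → PrefixFree T → v ∈ T → v′ ∈ T →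
    Unique (x ∷ xs) → Small x xs → (u , v) ∈ cycEdges x xs →
    ovLen v′ u′ + wCyc x xs ≤ ovLen v′ v → ovLen v′ u′ + wCyc x xs ≤ ovLen u u′ → ⊥
  overlap-bound {x = x} {xs} {u} {v} {u′} {v′} prefix-free v∈T v′∈T uniq small uv M≤c M≤d =
    let P , period , ∣P∣≡w = cycle-period uv
        as-∣P∣ : ∀ {n} → ovLen v′ u′ + wCyc x xs ≤ n → ovLen v′ u′ + length P ≤ n
        as-∣P∣ {n} = subst (λ w → ovLen v′ u′ + w ≤ n) (sym ∣P∣≡w)
    in period-overlap-bound {P = P} prefix-free v∈T v′∈T period
         (subst (0 <_) (sym ∣P∣≡w) (small-cycle-weight>0 uniq small uv)) (as-∣P∣ M≤c) (as-∣P∣ M≤d)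

open import Data.Integer using (ℤ; +_; _+_; _-_; _>_; _⊔_)
import Data.Integer as ℤ
import Data.Integer.Properties as ℤ
import Data.Integer.Tactic.RingSolver as ℤ-Solver

⊓+⊔ : ∀ c d → (c ℤ.⊓ d) + (c ⊔ d) ≡ c + d
⊓+⊔ c d with ℤ.≤-total c d
... | inj₁ c≤d = cong₂ _+_ (ℤ.i≤j⇒i⊓j≡i c≤d) (ℤ.i≤j⇒i⊔j≡j c≤d)
... | inj₂ d≤c = trans (cong₂ _+_ (ℤ.i≥j⇒i⊓j≡j d≤c) (ℤ.i≥j⇒i⊔j≡i d≤c)) (ℤ.+-comm d c)

min-max-gap : ∀ a b c d w → b + w > c ℤ.⊓ d → a + b - c - d > a - (c ⊔ d) - w
min-max-gap a b c d w gap = subst₂ ℤ._<_ (sym low≡) (sym (high≡ a b c d w)) (ℤ.+-monoʳ-< X gap)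
  where
  open ≡-Reasoning
  X = a - c - d - w
  high≡ : ∀ a b c d w → a + b - c - d ≡ (a - c - d - w) + (b + w)
  high≡ = ℤ-Solver.solve-∀
  regroup : ∀ a c d w M → a - M - w ≡ (a - c - d - w) + ((c + d) - M)
  regroup = ℤ-Solver.solve-∀
  cancel : ∀ X m M → X + ((m + M) - M) ≡ X + m
  cancel = ℤ-Solver.solve-∀
  low≡ : a - (c ⊔ d) - w ≡ X + (c ℤ.⊓ d)
  low≡ = begin
    a - (c ⊔ d) - w                           ≡⟨ regroup a c d w (c ⊔ d) ⟩
    X + ((c + d) - (c ⊔ d))                   ≡⟨ cong (λ t → X + (t - (c ⊔ d))) (⊓+⊔ c d) ⟨
    X + (((c ℤ.⊓ d) + (c ⊔ d)) - (c ⊔ d))     ≡⟨ cancel X (c ℤ.⊓ d) (c ⊔ d) ⟩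
    X + (c ℤ.⊓ d)                             ∎

lemma16 : {A : Set} (_≟A_ : DecidableEquality A) →
  let open Strings _≟A_ in
  (S : List Str) → Unique S → 2 ≤ length S → SubstringFree S →
  (ord : List Edge) → GreedyOrder S ord →
  (S' : List Str) → IsModification (mgreedy ord) S S' →
  (ord' : List Edge) → GreedyOrder S' ord' →
  (u v u' v' : Str) → u ∈ S' → v ∈ S' → u' ∈ S' → v' ∈ S' →
  (x : Str) (xs : List Str) → IsSmallCycleOf (mgreedy ord') x xs →
  (u , v) ∈ cycEdges x xs →
  (+ ovLen u v) + (+ ovLen v' u') - (+ ovLen v' v) - (+ ovLen u u')
    > (+ ovLen u v) - ((+ ovLen v' v) ⊔ (+ ovLen u u')) - (+ wCyc x xs)
lemma16 _≟A_ _ _ _ substring-free _ greedy S' modification _ _ u v u' v' _ v∈S' _ v'∈S' x xs (cycle , small) uv =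
  min-max-gap (+ ovLen u v) (+ ovLen v' u') (+ ovLen v' v) (+ ovLen u u') (+ wCyc x xs) (ℤ.≰⇒> no-long-overlaps)
  where
  open OverlapGraph _≟A_
  S'-prefix-free : PrefixFree S'
  S'-prefix-free = modification-PrefixFree (SubstringFree⇒PrefixFree substring-free) greedy modification
  no-long-overlaps : ¬ (+ ovLen v' u' + + wCyc x xs ℤ.≤ + ovLen v' v ℤ.⊓ + ovLen u u')
  no-long-overlaps h =
    overlap-bound S'-prefix-free v∈S' v'∈S' (proj₁ cycle) small uv
      (ℤ.drop‿+≤+ (ℤ.≤-trans h (ℤ.i⊓j≤i _ _))) (ℤ.drop‿+≤+ (ℤ.≤-trans h (ℤ.i⊓j≤j _ _)))
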